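{- Let $(p_a^\alpha(x))$ be the associated graded sequence of a delta operator $f(D)$, and let $g(D)=f(D)/D$. Then for all integers $a\ne0,1$ and all logarithmic indices $\alpha\ne(0)$, $$p_a^\alpha(x)=\sigma\,g(D)^{ -a}\lambda_{a-1}^\alpha(x),$$ where $\sigma$ is the standard Roman shift.
   Context: Setting (discrete case of the logarithmic umbral calculus). For $a\in\mathbb{Z}$ let $\lfloor a\rceil=a$ if $a\neq0$, $\lfloor 0\rceil=1$; $\lfloor a\rceil!=a!$ for $a\ge0$, $\lfloor a\rceil!=(-1)^{ -a-1}/(-a-1)!$ for $a<0$. Harmonic logarithms $\lambda_a^\alpha(x)$ ($a\in\mathbb{Z}$, $\alpha$ a logarithmic index): $\lambda_a^{(0)}=x^a$ for $a\ge0$, $0$ for $a<0$; $\lambda_a^{(1)}=x^a(\log x-H_a)$ for $a\ge0$, $x^a$ for $a<0$; higher indices involve iterated logarithms. $\mathcal{I}^\alpha$: formal series $\sum_{b\le N}c_b\lambda_b^\alpha$. $D\lambda_a^\alpha=\lfloor a\rceil\lambda_{a-1}^\alpha$; Artinian operators $\sum_{a\ge k}c_aD^a$ (a field) act via $D^b\lambda_a^\alpha=\frac{\lfloor a\rceil!}{\lfloor a-b\rceil!}\lambda_{a-b}^\alpha$; delta operators are $\sum_{a\ge1}c_aD^a$ with $c_1\ne0$. $\langle\alpha\mid p\rangle$ = coefficient of $\lambda_0^\alpha$ in $p$. A graded sequence is a regular family $(p_a^\alpha)$, $p_a^\alpha\in\mathcal{I}^\alpha$ of degree $a$ (coefficients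 independent of $\alpha\ne(0)$; $p_a^{(0)}$ obtained from $p_a^{(1)}$ by $\lambda_b^{(1)}\mapsto\lambda_b^{(0)}$). The associated graded sequence of a delta operator $f(D)$ is the unique graded sequence with $\langle\alpha\mid p_0^\alpha\rangle=1$, $\langle\alpha\mid p_a^\alpha\rangle=0$ ($a\ne0$), $f(D)p_a^\alpha=\lfloor a\rceil p_{a-1}^\alpha$. The standard Roman shift $\sigma$ is the linear operator with $\sigma\lambda_a^\alpha=\lambda_{a+1}^\alpha$ for $a\ne-1$ and $\sigma\lambda_{ -1}^\alpha=0$. -}

module Defs where

open import Level using (Level; _⊔_) renaming (suc to lsuc)
open import Algebra.Bundles using (CommutativeRing)
open import Data.Nat as ℕ using (ℕ; zero; suc)
open import Data.Integer as ℤ using (ℤ; +_; -[1+_])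
open import Data.Vec using (Vec; []; _∷_; head)
open import Data.Product using (_×_)
open import Relation.Nullary using (¬_; yes; no)

record Field (c ℓ : Level) : Set (lsuc (c ⊔ ℓ)) where
  field
    commutativeRing : CommutativeRing c ℓ
  open CommutativeRing commutativeRing public
  field
    1≉0     : ¬ (1# ≈ 0#)
    inv     : (x : Carrier) → ¬ (x ≈ 0#) → Carrier
    inv-law : (x : Carrier) (nz : ¬ (x ≈ 0#)) → x * inv x nz ≈ 1#

module Over {c ℓ : Level} (F : Field c ℓ) where
  open Field F public

  fromℕ : ℕ → Carrier
  fromℕ zero    = 0#
  fromℕ (suc n) = 1# + fromℕ n

  fromℤ : ℤ → Carrier
  fromℤ (+ n)      = fromℕ n
  fromℤ -[1+ n ]   = - fromℕ (suc n)

  CharZero : Set ℓ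
  CharZero = (n : ℕ) → ¬ (fromℕ (suc n) ≈ 0#)

  sumTo : ℕ → (ℕ → Carrier) → Carrier
  sumTo zero    t = 0#
  sumTo (suc n) t = sumTo n t + t n

  -- Operators  Σ_{n ≥ 0} h n D^n  (formal power series in D)

  PS : Set c
  PS = ℕ → Carrier

  onePS : PS
  onePS zero    = 1#
  onePS (suc _) = 0#

  -- Cauchy product = composition of operators
  mulPS : PS → PS → PS
  mulPS h k n = sumTo (suc n) (λ i → h i * k (n ℕ.∸ i))

  powPS : PS → ℕ → PS
  powPS h zero    = onePS
  powPS h (suc e) = mulPS h (powPS h e)

  -- multiplicative inverse of a power series with nonzero constant term:
  -- b 0 = h0⁻¹ ,  b n = - h0⁻¹ * Σ_{i=1}^{n} h i * b (n - i)
  module _ (h : PS) (nz : ¬ (h 0 ≈ 0#)) where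
    private
      c₀ : Carrier
      c₀ = inv (h 0) nz
      dot : ∀ {m} → ℕ → Vec Carrier m → Carrier
      dot k []       = 0#
      dot k (b ∷ bs) = h (suc k) * b + dot (suc k) bs
      -- invVec n = [b_n, b_{n-1}, …, b_0]
      invVec : (n : ℕ) → Vec Carrier (suc n)
      invVec zero    = c₀ ∷ []
      invVec (suc n) = (- (c₀ * dot 0 (invVec n))) ∷ invVec n
    invPS : PS
    invPS n = head (invVec n)

  powZ : (h : PS) → ¬ (h 0 ≈ 0#) → ℤ → PS
  powZ h nz (+ e)      = powPS h e
  powZ h nz -[1+ e ]   = powPS (invPS h nz) (suc e)

  IsDelta : PS → Set ℓ
  IsDelta f = (f 0 ≈ 0#) × ¬ (f 1 ≈ 0#)

  divD : PS → PS
  divD f n = f (suc n)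

  -- Elements of I^α (α ≠ (0)) : formal series Σ_{b ≤ N} c b λ_b^α,
  -- represented by the coefficient function c : ℤ → K (c b = 0 for b > N).

  rnd : ℤ → ℤ
  rnd (+ zero) = + 1
  rnd a        = a

  -- D^n λ_a = ff a n λ_{a-n},  ff a n = ⌊a⌉⌊a-1⌉…⌊a-n+1⌉ (= ⌊a⌉!/⌊a-n⌉!)
  ff : ℤ → ℕ → ℤ
  ff a zero    = + 1
  ff a (suc n) = rnd a ℤ.* ff (a ℤ.- + 1) n

  nat : ℤ → ℕ
  nat (+ n)    = n
  nat -[1+ _ ] = 0

  -- coefficient of λ_m in h(D) (Σ_{b ≤ N} c b λ_b):
  --   Σ_{n = 0}^{N - m} h n * ff (m + n) n * c (m + n)
  act : PS → ℤ → (ℤ → Carrier) → ℤ → Carrier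
  act h N c m =
    sumTo (nat (N ℤ.- m ℤ.+ + 1))
          (λ n → h n * (fromℤ (ff (m ℤ.+ + n) n) * c (m ℤ.+ + n)))

  lam : ℤ → ℤ → Carrier
  lam b m with m ℤ.≟ b
  ... | yes _ = 1#
  ... | no  _ = 0#

  -- standard Roman shift: σ λ_a = λ_{a+1} (a ≠ -1), σ λ_{-1} = 0
  shift : (ℤ → Carrier) → ℤ → Carrier
  shift c m with m ℤ.≟ + 0
  ... | yes _ = 0#
  ... | no  _ = c (m ℤ.- + 1)

-- The candidate is the transfer formula q_a = f′(D) g(D)^(-a-1) λ_a. Its λ_(a-j)-coefficient is
-- ⌊a⌉!/⌊a-j⌉! times the t^j-coefficient of f′ g^(-a-1), so f(D) q_a = ⌊a⌉ q_(a-1) reduces to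
-- g · f′ g^(-a-1) = f′ g^(-a), and ⟨α | q_0⟩ = f′(0)/g(0) = 1. Associated sequences are unique: the
-- difference d of two satisfies f(D) d_a = ⌊a⌉ d_(a-1), and comparing λ_(a-k-1)-coefficients shows,
-- by induction on k, that the λ_(a-k)-coefficient of d_a vanishes for all a as soon as it does for one
-- (g(0) ≠ 0 and ⌊·⌉ never vanishes); it does for a = k, since ⟨α | d_k⟩ = 0. Finally, with θ = t d/dt,
-- the power rule g θ(g^(-b)) = -b θg g^(-b) gives a f′ g^(-a-1) = (a - θ) g^(-a), which turns the
-- coefficients of a q_a into those of a σ g(D)^(-a) λ_(a-1); as σ λ_(-1) = 0 this also shows
-- ⟨α | q_a⟩ = 0 for a ≠ 0.

module Submission where

open import Defs
open import Level using (Level)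
open import Data.Integer using (ℤ; +_)
open import Data.Integer as ℤ using ()
open import Data.Product using (_×_; proj₂)
open import Relation.Nullary using (¬_)
open import Relation.Binary.PropositionalEquality using (_≢_)

open import Algebra.Bundles using (CommutativeRing)
open import Algebra.Solver.Ring.AlmostCommutativeRing using (fromCommutativeRing; _-Raw-AlmostCommutative⟶_)
import Algebra.Solver.Ring as RingSolver
import Algebra.Properties.CommutativeSemigroup as CommutativeSemigroupProperties
import Algebra.Properties.Group as GroupProperties
import Algebra.Properties.Ring as RingProperties
open import Data.Integer.Base using (-[1+_])
open import Data.Integer.Tactic.RingSolver using (solve-∀)
import Data.Integer.Properties as ℤP
open import Data.Maybe as Maybe using ()
open import Data.Nat as ℕ using (ℕ; zero; suc; _<_; s≤s; z≤n)
import Algebra.Construct.Pointwise ℕ as Pointwise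
open import Data.Nat.Induction using (<-rec)
import Data.Nat.Properties as ℕP
open import Data.Product using (_,_; proj₁)
open import Function using (_∘_)
open import Function.Bundles using (_⇔_; mk⇔; Equivalence)
import Function.Properties.Equivalence as ⇔
open import Relation.Binary.PropositionalEquality as ≡ using (_≡_)
open import Relation.Nullary using (yes; no; contradiction)
open import Relation.Nullary.Decidable using (dec⇒maybe)
import Relation.Binary.Reasoning.Setoid as SetoidReasoning

ℤ-induction : ∀ {p} (P : ℤ → Set p) → (∀ i → P i ⇔ P (ℤ.suc i)) → ∀ {i} → P i → ∀ j → P j
ℤ-induction P step {i} Pi j = Equivalence.from (P⇔P0 j) (Equivalence.to (P⇔P0 i) Pi)
  where
  P⇔P0 : ∀ j → P j ⇔ P (+ 0)
  P⇔P0 (+ zero)        = ⇔.refl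
  P⇔P0 (+ suc n)       = ⇔.trans (⇔.sym (step (+ n))) (P⇔P0 (+ n))
  P⇔P0 -[1+ zero ]     = step -[1+ 0 ]
  P⇔P0 -[1+ suc n ]    = ⇔.trans (step -[1+ suc n ]) (P⇔P0 -[1+ n ])

i-[i-j]≡j : ∀ i j → i ℤ.- (i ℤ.- j) ≡ j
i-[i-j]≡j = solve-∀

i-[i-j]+1≡1+j : ∀ i j → i ℤ.- (i ℤ.- j) ℤ.+ + 1 ≡ + 1 ℤ.+ j
i-[i-j]+1≡1+j = solve-∀

i-[i+[1+j]]+1≡-j : ∀ i j → i ℤ.- (i ℤ.+ (+ 1 ℤ.+ j)) ℤ.+ + 1 ≡ ℤ.- j
i-[i+[1+j]]+1≡-j = solve-∀

i-j+k≡i-[j-k] : ∀ i j k → i ℤ.- j ℤ.+ k ≡ i ℤ.- (j ℤ.- k)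
i-j+k≡i-[j-k] = solve-∀

i-1-j≡i-[1+j] : ∀ i j → i ℤ.- + 1 ℤ.- j ≡ i ℤ.- (+ 1 ℤ.+ j)
i-1-j≡i-[1+j] = solve-∀

i+j-1≡i-1+j : ∀ i j → i ℤ.+ j ℤ.- + 1 ≡ i ℤ.- + 1 ℤ.+ j
i+j-1≡i-1+j = solve-∀

i-j-1≡i-1-j : ∀ i j → i ℤ.- j ℤ.- + 1 ≡ i ℤ.- + 1 ℤ.- j
i-j-1≡i-1-j = solve-∀

1+[i-1]≡i : ∀ i → + 1 ℤ.+ (i ℤ.- + 1) ≡ i
1+[i-1]≡i = solve-∀

i+j≡i-1+[1+j] : ∀ i j → i ℤ.+ j ≡ i ℤ.- + 1 ℤ.+ (+ 1 ℤ.+ j)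
i+j≡i-1+[1+j] = solve-∀

[1+i]-1≡i : ∀ i → + 1 ℤ.+ i ℤ.- + 1 ≡ i
[1+i]-1≡i = solve-∀

i<i+[1+j] : ∀ i j → i ℤ.< i ℤ.+ + suc j
i<i+[1+j] i j = ≡.subst (ℤ._< i ℤ.+ + suc j) (ℤP.+-identityʳ i) (ℤP.+-monoʳ-< i (ℤ.+<+ (s≤s z≤n)))

+m-+n≡+[m∸n] : ∀ {m n} → n ℕ.≤ m → + m ℤ.- + n ≡ + (m ℕ.∸ n)
+m-+n≡+[m∸n] {m} {n} n≤m = ≡.trans (ℤP.m-n≡m⊖n m n) (ℤP.⊖-≥ n≤m)

i-[1+j]≢i : ∀ i j → i ℤ.- + suc j ≢ i
i-[1+j]≢i i j eq = contradiction 1+j≡0 (λ ())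
  where
  open ≡.≡-Reasoning
  1+j≡0 : + suc j ≡ + 0
  1+j≡0 = begin
    + suc j                   ≡⟨ i-[i-j]≡j i (+ suc j) ⟨
    i ℤ.- (i ℤ.- + suc j)     ≡⟨ ≡.cong (λ k → i ℤ.- k) eq ⟩
    i ℤ.- i                   ≡⟨ ℤP.+-inverseʳ i ⟩
    + 0                       ∎

data Position (i : ℤ) : ℤ → Set where
  atOrBelow : ∀ k → Position i (i ℤ.- + k)
  above     : ∀ k → Position i (i ℤ.+ + suc k)

position : ∀ i j → Position i j
position i j = ≡.subst (Position i) (i-[i-j]≡j i j) (from (i ℤ.- j))
  where
  from : ∀ k → Position i (i ℤ.- k)
  from (+ k)      = atOrBelow k
  from -[1+ k ]   = above k

module IntegerEmbedding {c ℓ : Level} (R : CommutativeRing c ℓ) where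
  open CommutativeRing R
  open SetoidReasoning setoid
  open RingProperties ring using (-‿involutive; -‿+-comm; -0#≈0#; -‿distribˡ-*)

  fromℕ : ℕ → Carrier
  fromℕ zero    = 0#
  fromℕ (suc n) = 1# + fromℕ n

  fromℤ : ℤ → Carrier
  fromℤ (+ n)    = fromℕ n
  fromℤ -[1+ n ] = - fromℕ (suc n)

  fromℕ-+ : ∀ m n → fromℕ (m ℕ.+ n) ≈ fromℕ m + fromℕ n
  fromℕ-+ zero    n = sym (+-identityˡ (fromℕ n))
  fromℕ-+ (suc m) n = trans (+-congˡ (fromℕ-+ m n)) (sym (+-assoc 1# (fromℕ m) (fromℕ n)))

  fromℤ-⊖ : ∀ m n → fromℤ (m ℤ.⊖ n) ≈ fromℕ m - fromℕ n
  fromℤ-⊖ m       zero    = sym (trans (+-congˡ -0#≈0#) (+-identityʳ (fromℕ m)))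
  fromℤ-⊖ zero    (suc n) = sym (+-identityˡ _)
  fromℤ-⊖ (suc m) (suc n) = begin
    fromℤ (suc m ℤ.⊖ suc n)            ≡⟨ ≡.cong fromℤ (ℤP.[1+m]⊖[1+n]≡m⊖n m n) ⟩
    fromℤ (m ℤ.⊖ n)                    ≈⟨ fromℤ-⊖ m n ⟩
    fromℕ m - fromℕ n                  ≈⟨ +-identityˡ _ ⟨
    0# + (fromℕ m - fromℕ n)           ≈⟨ +-congʳ (-‿inverseʳ 1#) ⟨
    (1# - 1#) + (fromℕ m - fromℕ n)    ≈⟨ +-assoc 1# (- 1#) _ ⟩
    1# + (- 1# + (fromℕ m - fromℕ n))  ≈⟨ +-congˡ (+-comm (- 1#) _) ⟩
    1# + ((fromℕ m - fromℕ n) - 1#)    ≈⟨ +-congˡ (+-assoc (fromℕ m) _ _) ⟩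
    1# + (fromℕ m + (- fromℕ n - 1#))  ≈⟨ +-assoc 1# (fromℕ m) _ ⟨
    fromℕ (suc m) + (- fromℕ n - 1#)   ≈⟨ +-congˡ (trans (+-comm _ _) (-‿+-comm 1# (fromℕ n))) ⟩
    fromℕ (suc m) - fromℕ (suc n)      ∎

  fromℤ-+ : ∀ i j → fromℤ (i ℤ.+ j) ≈ fromℤ i + fromℤ j
  fromℤ-+ (+ m)    (+ n)    = fromℕ-+ m n
  fromℤ-+ (+ m)    -[1+ n ] = fromℤ-⊖ m (suc n)
  fromℤ-+ -[1+ m ] (+ n)    = trans (fromℤ-⊖ n (suc m)) (+-comm _ _)
  fromℤ-+ -[1+ m ] -[1+ n ] = begin
    - fromℕ (suc (suc (m ℕ.+ n)))        ≡⟨ ≡.cong (λ k → - fromℕ (suc k)) (ℕP.+-suc m n) ⟨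
    - fromℕ (suc m ℕ.+ suc n)            ≈⟨ -‿cong (fromℕ-+ (suc m) (suc n)) ⟩
    - (fromℕ (suc m) + fromℕ (suc n))    ≈⟨ -‿+-comm _ _ ⟨
    - fromℕ (suc m) + - fromℕ (suc n)    ∎

  fromℤ-neg : ∀ i → fromℤ (ℤ.- i) ≈ - fromℤ i
  fromℤ-neg (+ zero)  = sym -0#≈0#
  fromℤ-neg (+ suc n) = refl
  fromℤ-neg -[1+ n ]  = sym (-‿involutive _)

  fromℤ-+* : ∀ m j → fromℤ (+ m ℤ.* j) ≈ fromℕ m * fromℤ j
  fromℤ-+* zero    j = sym (zeroˡ (fromℤ j))
  fromℤ-+* (suc m) j = begin
    fromℤ (+ suc m ℤ.* j)               ≡⟨ ≡.cong fromℤ (ℤP.suc-* (+ m) j) ⟩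
    fromℤ (j ℤ.+ + m ℤ.* j)             ≈⟨ fromℤ-+ j (+ m ℤ.* j) ⟩
    fromℤ j + fromℤ (+ m ℤ.* j)         ≈⟨ +-cong (sym (*-identityˡ _)) (fromℤ-+* m j) ⟩
    1# * fromℤ j + fromℕ m * fromℤ j    ≈⟨ distribʳ _ _ _ ⟨
    fromℕ (suc m) * fromℤ j             ∎

  fromℤ-* : ∀ i j → fromℤ (i ℤ.* j) ≈ fromℤ i * fromℤ j
  fromℤ-* (+ m)    j = fromℤ-+* m j
  fromℤ-* -[1+ m ] j = begin
    fromℤ (-[1+ m ] ℤ.* j)              ≡⟨ ≡.cong fromℤ (ℤP.neg-distribˡ-* (+ suc m) j) ⟨
    fromℤ (ℤ.- (+ suc m ℤ.* j))         ≈⟨ fromℤ-neg (+ suc m ℤ.* j) ⟩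
    - fromℤ (+ suc m ℤ.* j)             ≈⟨ -‿cong (fromℤ-+* (suc m) j) ⟩
    - (fromℕ (suc m) * fromℤ j)         ≈⟨ -‿distribˡ-* _ _ ⟩
    - fromℕ (suc m) * fromℤ j           ∎

  morphism : ℤ.+-*-rawRing -Raw-AlmostCommutative⟶ fromCommutativeRing R
  morphism = record
    { ⟦_⟧    = fromℤ
    ; +-homo = fromℤ-+
    ; *-homo = fromℤ-*
    ; -‿homo = fromℤ-neg
    ; 0-homo = refl
    ; 1-homo = +-identityʳ 1#
    }

  -- Integer coefficients have decidable equality, so the solver can cancel terms such as x - x,
  -- which it cannot do with coefficients taken from an arbitrary carrier.
  open RingSolver ℤ.+-*-rawRing (fromCommutativeRing R) morphism
    (λ i j → Maybe.map (λ i≡j → reflexive (≡.cong fromℤ i≡j)) (dec⇒maybe (i ℤ.≟ j)))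
    public using (solve; _:=_; _:+_; _:*_; _:-_; :-_)

module CommutativeRingProperties {c ℓ : Level} (R : CommutativeRing c ℓ) where
  open CommutativeRing R
  open SetoidReasoning setoid
  open IntegerEmbedding R using (solve; _:=_; _:+_; _:*_; _:-_; :-_)

  *-cancelˡ-invertible : ∀ {g w x y} → g * w ≈ 1# → g * x ≈ g * y → x ≈ y
  *-cancelˡ-invertible {g} {w} {x} {y} gw≈1 gx≈gy = begin
    x              ≈⟨ *-identityˡ x ⟨
    1# * x         ≈⟨ *-congʳ wg≈1 ⟨
    (w * g) * x    ≈⟨ *-assoc w g x ⟩
    w * (g * x)    ≈⟨ *-congˡ gx≈gy ⟩
    w * (g * y)    ≈⟨ *-assoc w g y ⟨
    (w * g) * y    ≈⟨ *-congʳ wg≈1 ⟩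
    1# * y         ≈⟨ *-identityˡ y ⟩
    y              ∎
    where
    wg≈1 : w * g ≈ 1#
    wg≈1 = trans (*-comm w g) gw≈1

  module Derivation
    (∂ : Carrier → Carrier)
    (∂-cong : ∀ {x y} → x ≈ y → ∂ x ≈ ∂ y)
    (∂-leibniz : ∀ x y → ∂ (x * y) ≈ ∂ x * y + x * ∂ y)
    {g w : Carrier} (gw≈1 : g * w ≈ 1#)
    where

    private
      cancel-g : ∀ {x y} → g * x ≈ g * y → x ≈ y
      cancel-g = *-cancelˡ-invertible gw≈1

      ∂-product : ∀ {k k′} → k ≈ g * k′ → g * ∂ k ≈ ∂ g * k + g * (g * ∂ k′)
      ∂-product {k} {k′} k≈gk′ = begin
        g * ∂ k
          ≈⟨ *-congˡ (trans (∂-cong k≈gk′) (∂-leibniz g k′)) ⟩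
        g * (∂ g * k′ + g * ∂ k′)
          ≈⟨ solve 4 (λ g d k d′ → g :* (d :* k :+ g :* d′) := d :* (g :* k) :+ g :* (g :* d′))
                   refl g (∂ g) k′ (∂ k′) ⟩
        ∂ g * (g * k′) + g * (g * ∂ k′)
          ≈⟨ +-congʳ (*-congˡ (sym k≈gk′)) ⟩
        ∂ g * k + g * (g * ∂ k′)
          ∎

    log-derivative-step : ∀ {k k′ c c′} → k ≈ g * k′ → c′ ≈ c + 1# →
      g * ∂ k ≈ - (c * (∂ g * k)) ⇔ g * ∂ k′ ≈ - (c′ * (∂ g * k′))
    log-derivative-step {k} {k′} {c} {c′} k≈gk′ c′≈c+1 = mk⇔ forward backward
      where
      c′-times : ∀ x → c′ * x ≈ c * x + x
      c′-times x = trans (*-congʳ c′≈c+1) (trans (distribʳ x c 1#) (+-congˡ (*-identityˡ x)))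

      forward : g * ∂ k ≈ - (c * (∂ g * k)) → g * ∂ k′ ≈ - (c′ * (∂ g * k′))
      forward hyp = cancel-g (begin
        g * (g * ∂ k′)
          ≈⟨ solve 2 (λ a y → y := a :+ y :- a) refl (∂ g * k) (g * (g * ∂ k′)) ⟩
        (∂ g * k + g * (g * ∂ k′)) - ∂ g * k
          ≈⟨ +-congʳ (trans (sym (∂-product k≈gk′)) hyp) ⟩
        - (c * (∂ g * k)) - ∂ g * k
          ≈⟨ solve 2 (λ c x → :- (c :* x) :- x := :- (c :* x :+ x)) refl c (∂ g * k) ⟩
        - (c * (∂ g * k) + ∂ g * k)
          ≈⟨ -‿cong (trans (sym (c′-times (∂ g * k))) (*-congˡ (*-congˡ k≈gk′))) ⟩
        - (c′ * (∂ g * (g * k′)))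
          ≈⟨ solve 4 (λ g c′ d k′ → :- (c′ :* (d :* (g :* k′))) := g :* :- (c′ :* (d :* k′)))
                   refl g c′ (∂ g) k′ ⟩
        g * - (c′ * (∂ g * k′))
          ∎)

      backward : g * ∂ k′ ≈ - (c′ * (∂ g * k′)) → g * ∂ k ≈ - (c * (∂ g * k))
      backward hyp = begin
        g * ∂ k
          ≈⟨ trans (∂-product k≈gk′) (+-congˡ (*-congˡ hyp)) ⟩
        ∂ g * k + g * - (c′ * (∂ g * k′))
          ≈⟨ solve 5 (λ x g c′ d k′ → x :+ g :* :- (c′ :* (d :* k′)) := x :- c′ :* (d :* (g :* k′)))
                   refl (∂ g * k) g c′ (∂ g) k′ ⟩
        ∂ g * k - c′ * (∂ g * (g * k′))
          ≈⟨ +-congˡ (-‿cong (trans (*-congˡ (*-congˡ (sym k≈gk′))) (c′-times (∂ g * k)))) ⟩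
        ∂ g * k - (c * (∂ g * k) + ∂ g * k)
          ≈⟨ solve 2 (λ x y → x :- (y :+ x) := :- y) refl (∂ g * k) (c * (∂ g * k)) ⟩
        - (c * (∂ g * k))
          ∎

    derivative-identity : ∀ {k k′ c} → k ≈ g * k′ → g * ∂ k ≈ - (c * (∂ g * k)) →
      c * ((g + ∂ g) * k′) ≈ c * k - ∂ k
    derivative-identity {k} {k′} {c} k≈gk′ hyp = cancel-g (begin
      g * (c * ((g + ∂ g) * k′))
        ≈⟨ solve 4 (λ g c d k′ → g :* (c :* ((g :+ d) :* k′)) := c :* (g :* (g :* k′)) :+ c :* (d :* (g :* k′)))
                 refl g c (∂ g) k′ ⟩
      c * (g * (g * k′)) + c * (∂ g * (g * k′))
        ≈⟨ +-cong (*-congˡ (*-congˡ (sym k≈gk′))) (*-congˡ (*-congˡ (sym k≈gk′))) ⟩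
      c * (g * k) + c * (∂ g * k)
        ≈⟨ solve 2 (λ x y → x :+ y := x :- :- y) refl (c * (g * k)) (c * (∂ g * k)) ⟩
      c * (g * k) - - (c * (∂ g * k))
        ≈⟨ +-congˡ (-‿cong hyp) ⟨
      c * (g * k) - g * ∂ k
        ≈⟨ solve 4 (λ g c k d → c :* (g :* k) :- g :* d := g :* (c :* k :- d)) refl g c k (∂ k) ⟩
      g * (c * k - ∂ k)
        ∎)

module Arithmetic {c ℓ : Level} (F : Field c ℓ) where
  open Over F
  open SetoidReasoning setoid
  private module ℤ↪ = IntegerEmbedding commutativeRing
  open ℤ↪ public using (solve; _:=_; _:+_; _:*_; _:-_; :-_)
  open CommutativeRingProperties commutativeRing using (*-cancelˡ-invertible)
  open RingProperties ring using (-‿involutive; -0#≈0#)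

  fromℤ≡ : ∀ i → fromℤ i ≡ ℤ↪.fromℤ i
  fromℤ≡ (+ n)    = fromℕ≡ n
    where
    fromℕ≡ : ∀ n → fromℕ n ≡ ℤ↪.fromℕ n
    fromℕ≡ zero    = ≡.refl
    fromℕ≡ (suc n) = ≡.cong (λ x → 1# + x) (fromℕ≡ n)
  fromℤ≡ -[1+ n ] = ≡.cong -_ (fromℤ≡ (+ suc n))

  fromℤ-+ : ∀ i j → fromℤ (i ℤ.+ j) ≈ fromℤ i + fromℤ j
  fromℤ-+ i j rewrite fromℤ≡ (i ℤ.+ j) | fromℤ≡ i | fromℤ≡ j = ℤ↪.fromℤ-+ i j

  fromℤ-* : ∀ i j → fromℤ (i ℤ.* j) ≈ fromℤ i * fromℤ j
  fromℤ-* i j rewrite fromℤ≡ (i ℤ.* j) | fromℤ≡ i | fromℤ≡ j = ℤ↪.fromℤ-* i j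

  fromℤ-neg : ∀ i → fromℤ (ℤ.- i) ≈ - fromℤ i
  fromℤ-neg i rewrite fromℤ≡ (ℤ.- i) | fromℤ≡ i = ℤ↪.fromℤ-neg i

  fromℕ-+ : ∀ m n → fromℕ (m ℕ.+ n) ≈ fromℕ m + fromℕ n
  fromℕ-+ m n = fromℤ-+ (+ m) (+ n)

  fromℤ-nonzero : CharZero → ∀ {i} → i ≢ + 0 → ¬ (fromℤ i ≈ 0#)
  fromℤ-nonzero charZero {+ zero}   i≢0 _  = i≢0 ≡.refl
  fromℤ-nonzero charZero {+ suc n}  _   eq = charZero n eq
  fromℤ-nonzero charZero { -[1+ n ]} _  eq =
    charZero n (trans (sym (-‿involutive _)) (trans (-‿cong eq) -0#≈0#))

  *-cancelˡ-nonzero : ∀ {x y z} → ¬ (x ≈ 0#) → x * y ≈ x * z → y ≈ z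
  *-cancelˡ-nonzero {x} x≉0 = *-cancelˡ-invertible (inv-law x x≉0)

  nonzero*y≈0⇒y≈0 : ∀ {x y} → ¬ (x ≈ 0#) → x * y ≈ 0# → y ≈ 0#
  nonzero*y≈0⇒y≈0 {x} x≉0 xy≈0 = *-cancelˡ-nonzero x≉0 (trans xy≈0 (sym (zeroʳ x)))

  sumTo-cong : ∀ n {t u : ℕ → Carrier} → (∀ i → i < n → t i ≈ u i) → sumTo n t ≈ sumTo n u
  sumTo-cong zero    t≈u = refl
  sumTo-cong (suc n) t≈u = +-cong (sumTo-cong n (λ i i<n → t≈u i (ℕP.m<n⇒m<1+n i<n))) (t≈u n ℕP.≤-refl)

  sumTo-zero : ∀ n {t : ℕ → Carrier} → (∀ i → i < n → t i ≈ 0#) → sumTo n t ≈ 0#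
  sumTo-zero n {t} t≈0 = trans (sumTo-cong n t≈0) (sumTo-0# n)
    where
    sumTo-0# : ∀ n → sumTo n (λ _ → 0#) ≈ 0#
    sumTo-0# zero    = refl
    sumTo-0# (suc n) = trans (+-identityʳ _) (sumTo-0# n)

  sumTo-single : ∀ n {t : ℕ → Carrier} j → j < n → (∀ i → i < n → i ≢ j → t i ≈ 0#) → sumTo n t ≈ t j
  sumTo-single (suc n) {t} j j<1+n others with j ℕ.≟ n
  ... | yes ≡.refl = trans (+-congʳ (sumTo-zero n (λ i i<n → others′ i i<n (ℕP.<⇒≢ i<n)))) (+-identityˡ (t n))
    where
    others′ : ∀ i → i < n → i ≢ j → t i ≈ 0#
    others′ i i<n = others i (ℕP.m<n⇒m<1+n i<n)
  ... | no j≢n     = trans (+-cong (sumTo-single n j j<n others′) (others n ℕP.≤-refl (j≢n ∘ ≡.sym))) (+-identityʳ (t j))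
    where
    j<n : j < n
    j<n = ℕP.≤∧≢⇒< (ℕP.≤-pred j<1+n) j≢n
    others′ : ∀ i → i < n → i ≢ j → t i ≈ 0#
    others′ i i<n = others i (ℕP.m<n⇒m<1+n i<n)

  sumTo-*ˡ : ∀ n x (t : ℕ → Carrier) → sumTo n (λ i → x * t i) ≈ x * sumTo n t
  sumTo-*ˡ zero    x t = sym (zeroʳ x)
  sumTo-*ˡ (suc n) x t = trans (+-congʳ (sumTo-*ˡ n x t)) (sym (distribˡ x _ _))

  sumTo-+ : ∀ n (t u : ℕ → Carrier) → sumTo n (λ i → t i + u i) ≈ sumTo n t + sumTo n u
  sumTo-+ zero    t u = sym (+-identityʳ 0#)
  sumTo-+ (suc n) t u = trans (+-congʳ (sumTo-+ n t u))
    (solve 4 (λ a b x y → (a :+ b) :+ (x :+ y) := (a :+ x) :+ (b :+ y)) refl _ _ _ _)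

  sumTo-- : ∀ n (t u : ℕ → Carrier) → sumTo n (λ i → t i - u i) ≈ sumTo n t - sumTo n u
  sumTo-- zero    t u = sym (-‿inverseʳ 0#)
  sumTo-- (suc n) t u = trans (+-congʳ (sumTo-- n t u))
    (solve 4 (λ a b x y → (a :- b) :+ (x :- y) := (a :+ x) :- (b :+ y)) refl _ _ _ _)

  sumTo-first : ∀ n (t : ℕ → Carrier) → sumTo (suc n) t ≈ t 0 + sumTo n (λ i → t (suc i))
  sumTo-first zero    t = trans (+-identityˡ (t 0)) (sym (+-identityʳ (t 0)))
  sumTo-first (suc n) t = trans (+-congʳ (sumTo-first n t)) (+-assoc _ _ _)

  sumTo-reverse : ∀ n (t : ℕ → Carrier) → sumTo (suc n) (λ i → t (n ℕ.∸ i)) ≈ sumTo (suc n) t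
  sumTo-reverse zero    t = refl
  sumTo-reverse (suc n) t = begin
    sumTo (suc (suc n)) (λ i → t (suc n ℕ.∸ i))      ≈⟨ sumTo-first (suc n) _ ⟩
    t (suc n) + sumTo (suc n) (λ i → t (n ℕ.∸ i))    ≈⟨ +-congˡ (sumTo-reverse n t) ⟩
    t (suc n) + sumTo (suc n) t                      ≈⟨ +-comm _ _ ⟩
    sumTo (suc (suc n)) t                            ∎

module PowerSeries {c ℓ : Level} (F : Field c ℓ) where
  open Over F
  open Arithmetic F
  open SetoidReasoning setoid

  infix 4 _≋_
  _≋_ : PS → PS → Set ℓ
  h ≋ k = ∀ i → h i ≈ k i

  mulPS-cong : ∀ {h h′ k k′} → h ≋ h′ → k ≋ k′ → mulPS h k ≋ mulPS h′ k′
  mulPS-cong h≋h′ k≋k′ s = sumTo-cong (suc s) (λ i _ → *-cong (h≋h′ i) (k≋k′ (s ℕ.∸ i)))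

  mulPS-congˡ : ∀ {h h′} k → h ≋ h′ → mulPS h k ≋ mulPS h′ k
  mulPS-congˡ k h≋h′ = mulPS-cong h≋h′ (λ i → refl {k i})

  mulPS-congʳ : ∀ h {k k′} → k ≋ k′ → mulPS h k ≋ mulPS h k′
  mulPS-congʳ h k≋k′ = mulPS-cong (λ i → refl {h i}) k≋k′

  mulPS-0 : ∀ h k → mulPS h k 0 ≈ h 0 * k 0
  mulPS-0 h k = +-identityˡ (h 0 * k 0)

  mulPS-suc : ∀ h k s → mulPS h k (suc s) ≈ h 0 * k (suc s) + mulPS (divD h) k s
  mulPS-suc h k s = sumTo-first (suc s) (λ i → h i * k (suc s ℕ.∸ i))

  mulPS-constantˡ : ∀ e h → (∀ i → e (suc i) ≈ 0#) → mulPS e h ≋ (λ s → e 0 * h s)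
  mulPS-constantˡ e h e≈0 s = sumTo-single (suc s) 0 (s≤s z≤n) vanishing
    where
    vanishing : ∀ i → i < suc s → i ≢ 0 → e i * h (s ℕ.∸ i) ≈ 0#
    vanishing zero    _ 0≢0 = contradiction ≡.refl 0≢0
    vanishing (suc i) _ _   = trans (*-congʳ (e≈0 i)) (zeroˡ _)

  mulPS-comm : ∀ h k → mulPS h k ≋ mulPS k h
  mulPS-comm h k s = begin
    mulPS h k s                                      ≈⟨ sumTo-cong (suc s) reflect ⟩
    sumTo (suc s) (λ i → t (s ℕ.∸ i))                ≈⟨ sumTo-reverse s t ⟩
    mulPS k h s                                      ∎
    where
    t : ℕ → Carrier
    t j = k j * h (s ℕ.∸ j)
    reflect : ∀ i → i < suc s → h i * k (s ℕ.∸ i) ≈ t (s ℕ.∸ i)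
    reflect i i<1+s =
      trans (*-comm _ _) (*-congˡ (reflexive (≡.cong h (≡.sym (ℕP.m∸[m∸n]≡n (ℕP.≤-pred i<1+s))))))

  mulPS-distribʳ : ∀ h h′ k → mulPS (λ i → h i + h′ i) k ≋ (λ s → mulPS h k s + mulPS h′ k s)
  mulPS-distribʳ h h′ k s = trans (sumTo-cong (suc s) (λ i _ → distribʳ _ _ _)) (sumTo-+ (suc s) _ _)

  mulPS-distribˡ : ∀ h k k′ → mulPS h (λ i → k i + k′ i) ≋ (λ s → mulPS h k s + mulPS h k′ s)
  mulPS-distribˡ h k k′ s = trans (sumTo-cong (suc s) (λ i _ → distribˡ _ _ _)) (sumTo-+ (suc s) _ _)

  mulPS-identityˡ : ∀ h → mulPS onePS h ≋ h
  mulPS-identityˡ h s = trans (mulPS-constantˡ onePS h (λ _ → refl) s) (*-identityˡ (h s))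

  mulPS-*ˡ : ∀ x h k → mulPS (λ i → x * h i) k ≋ (λ s → x * mulPS h k s)
  mulPS-*ˡ x h k s = trans (sumTo-cong (suc s) (λ i _ → *-assoc _ _ _)) (sumTo-*ˡ (suc s) x _)

  mulPS-assoc : ∀ h k l → mulPS (mulPS h k) l ≋ mulPS h (mulPS k l)
  mulPS-assoc h k l zero = begin
    mulPS (mulPS h k) l 0        ≈⟨ trans (mulPS-0 (mulPS h k) l) (*-congʳ (mulPS-0 h k)) ⟩
    (h 0 * k 0) * l 0            ≈⟨ *-assoc _ _ _ ⟩
    h 0 * (k 0 * l 0)            ≈⟨ trans (mulPS-0 h (mulPS k l)) (*-congˡ (mulPS-0 k l)) ⟨
    mulPS h (mulPS k l) 0        ∎
  mulPS-assoc h k l (suc s) = begin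
    mulPS (mulPS h k) l (suc s)
      ≈⟨ mulPS-suc (mulPS h k) l s ⟩
    mulPS h k 0 * l (suc s) + mulPS (divD (mulPS h k)) l s
      ≈⟨ +-cong (*-congʳ (mulPS-0 h k)) (mulPS-congˡ l (mulPS-suc h k) s) ⟩
    (h 0 * k 0) * l (suc s) + mulPS (λ i → h 0 * divD k i + mulPS (divD h) k i) l s
      ≈⟨ +-congˡ (trans (mulPS-distribʳ _ _ l s) (+-congʳ (mulPS-*ˡ (h 0) (divD k) l s))) ⟩
    (h 0 * k 0) * l (suc s) + (h 0 * mulPS (divD k) l s + mulPS (mulPS (divD h) k) l s)
      ≈⟨ +-congˡ (+-congˡ (mulPS-assoc (divD h) k l s)) ⟩
    (h 0 * k 0) * l (suc s) + (h 0 * mulPS (divD k) l s + mulPS (divD h) (mulPS k l) s)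
      ≈⟨ solve 5 (λ a b c d e → (a :* b) :* c :+ (a :* d :+ e) := a :* (b :* c :+ d) :+ e)
               refl _ _ _ _ _ ⟩
    h 0 * (k 0 * l (suc s) + mulPS (divD k) l s) + mulPS (divD h) (mulPS k l) s
      ≈⟨ trans (mulPS-suc h (mulPS k l) s) (+-congʳ (*-congˡ (mulPS-suc k l s))) ⟨
    mulPS h (mulPS k l) (suc s)
      ∎

  powerSeriesRing : CommutativeRing c ℓ
  powerSeriesRing = record
    { Carrier           = PS
    ; _≈_               = _≋_
    ; _+_               = λ h k i → h i + k i
    ; _*_               = mulPS
    ; -_                = λ h i → - h i
    ; 0#                = λ _ → 0#
    ; 1#                = onePS
    ; isCommutativeRing = record
      { isRing = record
        { +-isAbelianGroup = Pointwise.isAbelianGroup +-isAbelianGroup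
        ; *-cong           = mulPS-cong
        ; *-assoc          = mulPS-assoc
        ; *-identity       = mulPS-identityˡ , (λ h s → trans (mulPS-comm h onePS s) (mulPS-identityˡ h s))
        ; distrib          = mulPS-distribˡ , (λ k h h′ → mulPS-distribʳ h h′ k)
        }
      ; *-comm = mulPS-comm
      }
    }

  θ : PS → PS
  θ h i = fromℕ i * h i

  θ-cong : ∀ {h k} → h ≋ k → θ h ≋ θ k
  θ-cong h≋k i = *-congˡ (h≋k i)

  θ-leibniz : ∀ h k → θ (mulPS h k) ≋ (λ s → mulPS (θ h) k s + mulPS h (θ k) s)
  θ-leibniz h k s = sym (begin
    mulPS (θ h) k s + mulPS h (θ k) s
      ≈⟨ sumTo-+ (suc s) _ _ ⟨
    sumTo (suc s) (λ i → (fromℕ i * h i) * k (s ℕ.∸ i) + h i * (fromℕ (s ℕ.∸ i) * k (s ℕ.∸ i)))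
      ≈⟨ sumTo-cong (suc s) (λ i i<1+s → weights-add i (ℕP.≤-pred i<1+s)) ⟩
    sumTo (suc s) (λ i → fromℕ s * (h i * k (s ℕ.∸ i)))
      ≈⟨ sumTo-*ˡ (suc s) (fromℕ s) _ ⟩
    fromℕ s * mulPS h k s ∎)
    where
    weights-add : ∀ i → i ℕ.≤ s →
      (fromℕ i * h i) * k (s ℕ.∸ i) + h i * (fromℕ (s ℕ.∸ i) * k (s ℕ.∸ i)) ≈ fromℕ s * (h i * k (s ℕ.∸ i))
    weights-add i i≤s = begin
      (fromℕ i * h i) * k (s ℕ.∸ i) + h i * (fromℕ (s ℕ.∸ i) * k (s ℕ.∸ i))
        ≈⟨ solve 4 (λ a b c d → (a :* b) :* d :+ b :* (c :* d) := (a :+ c) :* (b :* d)) refl _ _ _ _ ⟩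
      (fromℕ i + fromℕ (s ℕ.∸ i)) * (h i * k (s ℕ.∸ i))
        ≈⟨ *-congʳ (fromℕ-+ i (s ℕ.∸ i)) ⟨
      fromℕ (i ℕ.+ (s ℕ.∸ i)) * (h i * k (s ℕ.∸ i))
        ≡⟨ ≡.cong (λ n → fromℕ n * (h i * k (s ℕ.∸ i))) (ℕP.m+[n∸m]≡n i≤s) ⟩
      fromℕ s * (h i * k (s ℕ.∸ i)) ∎

  θ-onePS : θ onePS ≋ (λ _ → 0#)
  θ-onePS zero    = zeroˡ 1#
  θ-onePS (suc i) = zeroʳ _

  convolution-recursion : (h b : PS) (C : ℕ → ℕ → Carrier) →
    (∀ k → C k 0 ≡ h (suc k) * b 0 + 0#) →
    (∀ k n → C k (suc n) ≡ h (suc k) * b (suc n) + C (suc k) n) →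
    ∀ k n → C k n ≈ mulPS (λ i → h (suc (k ℕ.+ i))) b n
  convolution-recursion h b C C-0 C-suc k zero = begin
    C k 0                          ≡⟨ C-0 k ⟩
    h (suc k) * b 0 + 0#           ≈⟨ +-comm _ _ ⟩
    0# + h (suc k) * b 0           ≡⟨ ≡.cong (λ n → 0# + h (suc n) * b 0) (ℕP.+-identityʳ k) ⟨
    mulPS (λ i → h (suc (k ℕ.+ i))) b 0 ∎
  convolution-recursion h b C C-0 C-suc k (suc n) = begin
    C k (suc n)
      ≡⟨ C-suc k n ⟩
    h (suc k) * b (suc n) + C (suc k) n
      ≈⟨ +-cong (*-congʳ (reflexive (≡.cong (λ m → h (suc m)) (≡.sym (ℕP.+-identityʳ k)))))
                (convolution-recursion h b C C-0 C-suc (suc k) n) ⟩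
    h (suc (k ℕ.+ 0)) * b (suc n) + mulPS (λ i → h (suc (suc k ℕ.+ i))) b n
      ≈⟨ +-congˡ (mulPS-congˡ b (λ i → reflexive (≡.cong (λ m → h (suc m)) (ℕP.+-suc k i))) n) ⟨
    h (suc (k ℕ.+ 0)) * b (suc n) + mulPS (λ i → h (suc (k ℕ.+ suc i))) b n
      ≈⟨ mulPS-suc (λ i → h (suc (k ℕ.+ i))) b n ⟨
    mulPS (λ i → h (suc (k ℕ.+ i))) b (suc n)
      ∎

  private
    unfolded : (h : PS) (h₀≉0 : ¬ (h 0 ≈ 0#)) (n : ℕ) (x : Carrier) →
      invPS h h₀≉0 (suc n) ≡ - (inv (h 0) h₀≉0 * x) → Carrier
    unfolded _ _ _ x _ = x

    -- `invPS h h₀≉0 (suc n)` unfolds to `- (inv (h 0) h₀≉0 * dot 0 (invVec n))` with helpers private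
    -- to Defs. `unfolded` exposes that term; abstracting its literal offset 0 turns it into the
    -- pattern `C k n`, so unification instantiates `convolution-recursion` with the private helper.
    unfolded≈ : (h : PS) (h₀≉0 : ¬ (h 0 ≈ 0#)) (n : ℕ) →
      unfolded h h₀≉0 n _ ≡.refl ≈ mulPS (divD h) (invPS h h₀≉0) n
    unfolded≈ h h₀≉0
      with 0 in 0≡k | convolution-recursion h (invPS h h₀≉0) _ (λ _ → ≡.refl) (λ _ _ → ≡.refl)
    ... | k | recursion = λ n → trans (recursion k n)
      (reflexive (≡.cong (λ j → mulPS (λ i → h (suc (j ℕ.+ i))) (invPS h h₀≉0) n) (≡.sym 0≡k)))

  invPS-suc : ∀ h h₀≉0 n → invPS h h₀≉0 (suc n) ≈ - (inv (h 0) h₀≉0 * mulPS (divD h) (invPS h h₀≉0) n)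
  invPS-suc h h₀≉0 n = -‿cong (*-congˡ (unfolded≈ h h₀≉0 n))

  invPS-inverse : ∀ h h₀≉0 → mulPS h (invPS h h₀≉0) ≋ onePS
  invPS-inverse h h₀≉0 zero    = trans (mulPS-0 h (invPS h h₀≉0)) (inv-law (h 0) h₀≉0)
  invPS-inverse h h₀≉0 (suc s) = begin
    mulPS h w (suc s)         ≈⟨ mulPS-suc h w s ⟩
    h 0 * w (suc s) + X       ≈⟨ +-congʳ (*-congˡ (invPS-suc h h₀≉0 s)) ⟩
    h 0 * - (h₀⁻¹ * X) + X    ≈⟨ solve 3 (λ a b x → a :* :- (b :* x) :+ x := x :- (a :* b) :* x) refl (h 0) h₀⁻¹ X ⟩
    X - (h 0 * h₀⁻¹) * X      ≈⟨ +-congˡ (-‿cong (trans (*-congʳ (inv-law (h 0) h₀≉0)) (*-identityˡ X))) ⟩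
    X - X                     ≈⟨ -‿inverseʳ X ⟩
    0#                        ∎
    where
    w : PS
    w = invPS h h₀≉0
    h₀⁻¹ : Carrier
    h₀⁻¹ = inv (h 0) h₀≉0
    X : Carrier
    X = mulPS (divD h) w s

  constant : Carrier → PS
  constant x zero    = x
  constant x (suc _) = 0#

  mulPS-constant : ∀ x h → mulPS (constant x) h ≋ (λ s → x * h s)
  mulPS-constant x h = mulPS-constantˡ (constant x) h (λ _ → refl)

  derivative : PS → PS
  derivative h n = fromℕ (suc n) * h (suc n)

  derivative≋ : ∀ h → derivative h ≋ (λ n → divD h n + θ (divD h) n)
  derivative≋ h n = trans (distribʳ (h (suc n)) 1# (fromℕ n)) (+-congʳ (*-identityˡ (h (suc n))))

module Factorials {c ℓ : Level} (F : Field c ℓ) where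
  open Over F
  open ≡.≡-Reasoning

  rnd≢0 : ∀ i → rnd i ≢ + 0
  rnd≢0 (+ zero)   ()
  rnd≢0 (+ suc n)  ()
  rnd≢0 -[1+ n ]   ()

  rnd-nonzero : ∀ {i} → i ≢ + 0 → rnd i ≡ i
  rnd-nonzero {+ zero}    i≢0 = contradiction ≡.refl i≢0
  rnd-nonzero {+ suc n}   _   = ≡.refl
  rnd-nonzero { -[1+ n ]} _   = ≡.refl

  ff-+ : ∀ a m n → ff a (m ℕ.+ n) ≡ ff a m ℤ.* ff (a ℤ.- + m) n
  ff-+ a zero    n = ≡.sym (≡.trans (ℤP.*-identityˡ _) (≡.cong (λ b → ff b n) (ℤP.+-identityʳ a)))
  ff-+ a (suc m) n = begin
    rnd a ℤ.* ff (a ℤ.- + 1) (m ℕ.+ n)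
      ≡⟨ ≡.cong (rnd a ℤ.*_) (ff-+ (a ℤ.- + 1) m n) ⟩
    rnd a ℤ.* (ff (a ℤ.- + 1) m ℤ.* ff (a ℤ.- + 1 ℤ.- + m) n)
      ≡⟨ ℤP.*-assoc (rnd a) _ _ ⟨
    ff a (suc m) ℤ.* ff (a ℤ.- + 1 ℤ.- + m) n
      ≡⟨ ≡.cong (λ b → ff a (suc m) ℤ.* ff b n) (i-1-j≡i-[1+j] a (+ m)) ⟩
    ff a (suc m) ℤ.* ff (a ℤ.- + suc m) n
      ∎

module Action {c ℓ : Level} (F : Field c ℓ) where
  open Over F
  open Arithmetic F
  open Factorials F
  open PowerSeries F
  open SetoidReasoning setoid

  falling : ℤ → ℕ → Carrier
  falling a n = fromℤ (ff a n)

  falling-+ : ∀ a m n → falling a (m ℕ.+ n) ≈ falling a m * falling (a ℤ.- + m) n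
  falling-+ a m n = trans (reflexive (≡.cong fromℤ (ff-+ a m n))) (fromℤ-* (ff a m) _)

  falling-suc : ∀ a n → falling a (suc n) ≈ fromℤ (rnd a) * falling (a ℤ.- + 1) n
  falling-suc a n = fromℤ-* (rnd a) (ff (a ℤ.- + 1) n)

  falling-1 : ∀ a → falling a 1 ≈ fromℤ (rnd a)
  falling-1 a = reflexive (≡.cong fromℤ (ℤP.*-identityʳ (rnd a)))

  falling-shift : ∀ {a j} → a ≢ + 0 → a ℤ.- + j ≢ + 0 →
                  fromℤ a * falling (a ℤ.- + 1) j ≈ falling a j * fromℤ (a ℤ.- + j)
  falling-shift {a} {j} a≢0 a-j≢0 = begin
    fromℤ a * falling (a ℤ.- + 1) j         ≡⟨ ≡.cong (λ i → fromℤ i * falling (a ℤ.- + 1) j) (rnd-nonzero a≢0) ⟨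
    fromℤ (rnd a) * falling (a ℤ.- + 1) j   ≈⟨ falling-suc a j ⟨
    falling a (suc j)                       ≡⟨ ≡.cong (falling a) (ℕP.+-comm 1 j) ⟩
    falling a (j ℕ.+ 1)                     ≈⟨ falling-+ a j 1 ⟩
    falling a j * falling (a ℤ.- + j) 1     ≈⟨ *-congˡ (falling-1 (a ℤ.- + j)) ⟩
    falling a j * fromℤ (rnd (a ℤ.- + j))   ≡⟨ ≡.cong (λ i → falling a j * fromℤ i) (rnd-nonzero a-j≢0) ⟩
    falling a j * fromℤ (a ℤ.- + j)         ∎

  actSummand : PS → (ℤ → Carrier) → ℤ → ℕ → Carrier
  actSummand h c m n = h n * (falling (m ℤ.+ + n) n * c (m ℤ.+ + n))

  act-− : ∀ h N (c c′ : ℤ → Carrier) m → act h N (λ i → c i - c′ i) m ≈ act h N c m - act h N c′ m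
  act-− h N c c′ m = trans (sumTo-cong L (λ n _ → distribute _ _ _ _)) (sumTo-- L _ _)
    where
    L : ℕ
    L = nat (N ℤ.- m ℤ.+ + 1)
    distribute : ∀ a b x y → a * (b * (x - y)) ≈ a * (b * x) - a * (b * y)
    distribute = solve 4 (λ a b x y → a :* (b :* (x :- y)) := a :* (b :* x) :- a :* (b :* y)) refl

  act-above : ∀ h N c t → act h N c (N ℤ.+ + suc t) ≈ 0#
  act-above h N c t = reflexive (≡.cong (λ L → sumTo L (actSummand h c (N ℤ.+ + suc t))) length≡0)
    where
    length≡0 : nat (N ℤ.- (N ℤ.+ + suc t) ℤ.+ + 1) ≡ 0
    length≡0 = ≡.trans (≡.cong nat (i-[i+[1+j]]+1≡-j N (+ t))) (nat-neg t)
      where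
      nat-neg : ∀ t → nat (ℤ.- + t) ≡ 0
      nat-neg zero    = ≡.refl
      nat-neg (suc t) = ≡.refl

  act-below : ∀ h N c k → act h N c (N ℤ.- + k) ≈
              sumTo (suc k) (λ n → h n * (falling (N ℤ.- + (k ℕ.∸ n)) n * c (N ℤ.- + (k ℕ.∸ n))))
  act-below h N c k = begin
    act h N c (N ℤ.- + k)
      ≡⟨ ≡.cong (λ L → sumTo L (actSummand h c (N ℤ.- + k))) (≡.cong nat (i-[i-j]+1≡1+j N (+ k))) ⟩
    sumTo (suc k) (actSummand h c (N ℤ.- + k))
      ≈⟨ sumTo-cong (suc k) (λ n n<1+k → reflexive (≡.cong (λ i → h n * (falling i n * c i)) (index n<1+k))) ⟩
    sumTo (suc k) (λ n → h n * (falling (N ℤ.- + (k ℕ.∸ n)) n * c (N ℤ.- + (k ℕ.∸ n))))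
      ∎
    where
    index : ∀ {n} → n < suc k → N ℤ.- + k ℤ.+ + n ≡ N ℤ.- + (k ℕ.∸ n)
    index {n} n<1+k = ≡.trans (i-j+k≡i-[j-k] N (+ k) (+ n)) (≡.cong (λ i → N ℤ.- i) (+m-+n≡+[m∸n] (ℕP.≤-pred n<1+k)))

  act-shaped : ∀ h N c (v : PS) → (∀ j → c (N ℤ.- + j) ≈ falling N j * v j) →
               ∀ k → act h N c (N ℤ.- + k) ≈ falling N k * mulPS h v k
  act-shaped h N c v shape k = begin
    act h N c (N ℤ.- + k)
      ≈⟨ act-below h N c k ⟩
    sumTo (suc k) (λ n → h n * (falling (N ℤ.- + (k ℕ.∸ n)) n * c (N ℤ.- + (k ℕ.∸ n))))
      ≈⟨ sumTo-cong (suc k) (λ n n<1+k → term (ℕP.≤-pred n<1+k)) ⟩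
    sumTo (suc k) (λ n → falling N k * (h n * v (k ℕ.∸ n)))
      ≈⟨ sumTo-*ˡ (suc k) (falling N k) _ ⟩
    falling N k * mulPS h v k
      ∎
    where
    term : ∀ {n} → n ℕ.≤ k →
           h n * (falling (N ℤ.- + (k ℕ.∸ n)) n * c (N ℤ.- + (k ℕ.∸ n))) ≈ falling N k * (h n * v (k ℕ.∸ n))
    term {n} n≤k = begin
      h n * (falling (N ℤ.- + (k ℕ.∸ n)) n * c (N ℤ.- + (k ℕ.∸ n)))
        ≈⟨ *-congˡ (*-congˡ (shape (k ℕ.∸ n))) ⟩
      h n * (falling (N ℤ.- + (k ℕ.∸ n)) n * (falling N (k ℕ.∸ n) * v (k ℕ.∸ n)))
        ≈⟨ solve 4 (λ a b x y → a :* (b :* (x :* y)) := (x :* b) :* (a :* y)) refl _ _ _ _ ⟩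
      (falling N (k ℕ.∸ n) * falling (N ℤ.- + (k ℕ.∸ n)) n) * (h n * v (k ℕ.∸ n))
        ≈⟨ *-congʳ (falling-+ N (k ℕ.∸ n) n) ⟨
      falling N (k ℕ.∸ n ℕ.+ n) * (h n * v (k ℕ.∸ n))
        ≡⟨ ≡.cong (λ m → falling N m * (h n * v (k ℕ.∸ n))) (ℕP.m∸n+n≡m n≤k) ⟩
      falling N k * (h n * v (k ℕ.∸ n))
        ∎

  lam-shaped : ∀ b j → lam b (b ℤ.- + j) ≈ falling b j * onePS j
  lam-shaped b zero    = begin
    lam b (b ℤ.- + 0)       ≈⟨ lam-≡ (ℤP.+-identityʳ b) ⟩
    1#                      ≈⟨ *-identityʳ 1# ⟨
    1# * 1#                 ≈⟨ *-congʳ (+-identityʳ 1#) ⟨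
    falling b 0 * onePS 0   ∎
    where
    lam-≡ : ∀ {m} → m ≡ b → lam b m ≈ 1#
    lam-≡ {m} m≡b with m ℤ.≟ b
    ... | yes _   = refl
    ... | no  m≢b = contradiction m≡b m≢b
  lam-shaped b (suc j) = trans lam-≢ (sym (zeroʳ (falling b (suc j))))
    where
    lam-≢ : lam b (b ℤ.- + suc j) ≈ 0#
    lam-≢ with b ℤ.- + suc j ℤ.≟ b
    ... | yes m≡b = contradiction m≡b (i-[1+j]≢i b j)
    ... | no  _   = refl

  act-lam : ∀ h b k → act h b (lam b) (b ℤ.- + k) ≈ falling b k * h k
  act-lam h b k = trans (act-shaped h b (lam b) onePS (lam-shaped b) k)
                        (*-congˡ (trans (mulPS-comm h onePS k) (mulPS-identityˡ h k)))

  shift-elim : ∀ {p} (P : Carrier → Set p) c m →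
               (m ≡ + 0 → P 0#) → (m ≢ + 0 → P (c (m ℤ.- + 1))) → P (shift c m)
  shift-elim P c m at-0 elsewhere with m ℤ.≟ + 0
  ... | yes m≡0 = at-0 m≡0
  ... | no  m≢0 = elsewhere m≢0

  record IsAssociated (f : PS) (p : ℤ → ℤ → Carrier) : Set ℓ where
    field
      vanishes-above : ∀ a t → p a (a ℤ.+ + suc t) ≈ 0#
      at-origin      : p (+ 0) (+ 0) ≈ 1#
      vanishes-at-0  : ∀ a → a ≢ + 0 → p a (+ 0) ≈ 0#
      lowering       : ∀ a m → act f a (p a) m ≈ fromℤ (rnd a) * p (a ℤ.- + 1) m

module Transfer {c ℓ : Level} (F : Field c ℓ) (charZero : Over.CharZero F) (f : Over.PS F)
                (δ : Over.IsDelta F f) where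
  open Over F
  open Arithmetic F
  open PowerSeries F
  open Action F
  open SetoidReasoning setoid
  open RingProperties ring using (-0#≈0#)
  private
    module S = CommutativeRing powerSeriesRing

  g : PS
  g = divD f

  f₀≈0 : f 0 ≈ 0#
  f₀≈0 = proj₁ δ

  g⁻¹ : PS
  g⁻¹ = invPS g (proj₂ δ)

  g*g⁻¹≋1 : g S.* g⁻¹ ≋ S.1#
  g*g⁻¹≋1 = invPS-inverse g (proj₂ δ)

  open CommutativeRingProperties.Derivation powerSeriesRing θ θ-cong θ-leibniz {g} {g⁻¹} g*g⁻¹≋1

  inversePower : ℤ → PS
  inversePower b = powZ g (proj₂ δ) (ℤ.- b)

  inversePower-step : ∀ b → g S.* inversePower (ℤ.suc b) ≋ inversePower b
  inversePower-step (+ zero)     = S.trans (mulPS-congʳ g (S.*-identityʳ g⁻¹)) g*g⁻¹≋1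
  inversePower-step (+ suc n)    =
    S.trans (S.sym (S.*-assoc g g⁻¹ (inversePower (+ suc n))))
            (S.trans (mulPS-congˡ (inversePower (+ suc n)) g*g⁻¹≋1) (S.*-identityˡ (inversePower (+ suc n))))
  inversePower-step -[1+ zero ]  = S.refl
  inversePower-step -[1+ suc n ] = S.refl

  scalar : ℤ → PS
  scalar b = constant (fromℤ b)

  -- The power rule θ(g^(-b)) = -b g^(-b-1) θg, multiplied by g: it holds at b = 0 and, g being a
  -- unit, passes between b and b + 1 in both directions.
  inversePower-log-derivative : ∀ b → g S.* θ (inversePower b) ≋ S.- (scalar b S.* (θ g S.* inversePower b))
  inversePower-log-derivative =
    ℤ-induction (λ b → g S.* θ (inversePower b) ≋ S.- (scalar b S.* (θ g S.* inversePower b)))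
                (λ b → log-derivative-step {inversePower b} {inversePower (ℤ.suc b)} (S.sym (inversePower-step b)) (scalar-suc b))
                {+ 0} at-0
    where
    scalar-suc : ∀ b → scalar (ℤ.suc b) ≋ scalar b S.+ S.1#
    scalar-suc b zero    = trans (fromℤ-+ (+ 1) b) (trans (+-comm _ _) (+-congˡ (+-identityʳ 1#)))
    scalar-suc b (suc i) = sym (+-identityʳ 0#)
    scalar-0 : scalar (+ 0) ≋ S.0#
    scalar-0 zero    = refl
    scalar-0 (suc i) = refl
    at-0 : g S.* θ S.1# ≋ S.- (scalar (+ 0) S.* (θ g S.* S.1#))
    at-0 i = trans (trans (mulPS-congʳ g θ-onePS i) (S.zeroʳ g i))
                   (sym (trans (-‿cong (trans (mulPS-congˡ (θ g S.* S.1#) scalar-0 i) (S.zeroˡ (θ g S.* S.1#) i)))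
                               -0#≈0#))

  transferSeries : ℤ → PS
  transferSeries a = derivative f S.* inversePower (ℤ.suc a)

  transferSeries-scaled : ∀ a j → fromℤ a * transferSeries a j ≈ fromℤ (a ℤ.- + j) * inversePower a j
  transferSeries-scaled a j = begin
    fromℤ a * transferSeries a j
      ≈⟨ mulPS-constant (fromℤ a) (transferSeries a) j ⟨
    (scalar a S.* transferSeries a) j
      ≈⟨ mulPS-congʳ (scalar a) (mulPS-congˡ (inversePower (ℤ.suc a)) (derivative≋ f)) j ⟩
    (scalar a S.* ((g S.+ θ g) S.* inversePower (ℤ.suc a))) j
      ≈⟨ derivative-identity {inversePower a} {inversePower (ℤ.suc a)} {scalar a}
                             (S.sym (inversePower-step a)) (inversePower-log-derivative a) j ⟩
    (scalar a S.* inversePower a) j - fromℕ j * inversePower a j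
      ≈⟨ +-congʳ (mulPS-constant (fromℤ a) (inversePower a) j) ⟩
    fromℤ a * inversePower a j - fromℕ j * inversePower a j
      ≈⟨ solve 3 (λ x n k → x :* k :- n :* k := (x :- n) :* k) refl _ _ _ ⟩
    (fromℤ a - fromℕ j) * inversePower a j
      ≈⟨ *-congʳ (trans (fromℤ-+ a (ℤ.- + j)) (+-congˡ (fromℤ-neg (+ j)))) ⟨
    fromℤ (a ℤ.- + j) * inversePower a j
      ∎

  transferSeries-step : ∀ a → g S.* transferSeries a ≋ transferSeries (a ℤ.- + 1)
  transferSeries-step a =
    S.trans (x∙yz≈y∙xz g (derivative f) (inversePower (ℤ.suc a)))
            (S.trans (mulPS-congʳ (derivative f) (inversePower-step a))
                     (S.reflexive (≡.cong (λ b → derivative f S.* inversePower b) (≡.sym (1+[i-1]≡i a)))))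
    where open CommutativeSemigroupProperties S.*-commutativeSemigroup using (x∙yz≈y∙xz)

  transfer : ℤ → ℤ → Carrier
  transfer a = act (transferSeries a) a (lam a)

  transfer-below : ∀ a j → transfer a (a ℤ.- + j) ≈ falling a j * transferSeries a j
  transfer-below a = act-lam (transferSeries a) a

  transfer-above : ∀ a t → transfer a (a ℤ.+ + suc t) ≈ 0#
  transfer-above a = act-above (transferSeries a) a (lam a)

  transfer-predecessor-vanishes : ∀ a k → transfer (a ℤ.- + 1) (a ℤ.+ + k) ≈ 0#
  transfer-predecessor-vanishes a k =
    trans (reflexive (≡.cong (transfer (a ℤ.- + 1)) (i+j≡i-1+[1+j] a (+ k)))) (transfer-above (a ℤ.- + 1) k)

  transfer-lowering : ∀ a m → act f a (transfer a) m ≈ fromℤ (rnd a) * transfer (a ℤ.- + 1) m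
  transfer-lowering a m with position a m
  ... | above t = begin
    act f a (transfer a) (a ℤ.+ + suc t)                  ≈⟨ act-above f a (transfer a) t ⟩
    0#                                                    ≈⟨ zeroʳ _ ⟨
    fromℤ (rnd a) * 0#                                    ≈⟨ *-congˡ (transfer-predecessor-vanishes a (suc t)) ⟨
    fromℤ (rnd a) * transfer (a ℤ.- + 1) (a ℤ.+ + suc t)  ∎
  ... | atOrBelow zero = begin
    act f a (transfer a) (a ℤ.- + 0)                      ≈⟨ act-below f a (transfer a) 0 ⟩
    0# + f 0 * (falling (a ℤ.- + 0) 0 * transfer a (a ℤ.- + 0))
                                                          ≈⟨ trans (+-identityˡ _) (trans (*-congʳ f₀≈0) (zeroˡ _)) ⟩
    0#                                                    ≈⟨ zeroʳ _ ⟨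
    fromℤ (rnd a) * 0#                                    ≈⟨ *-congˡ (transfer-predecessor-vanishes a 0) ⟨
    fromℤ (rnd a) * transfer (a ℤ.- + 1) (a ℤ.- + 0)      ∎
  ... | atOrBelow (suc s) = begin
    act f a (transfer a) (a ℤ.- + suc s)
      ≈⟨ act-shaped f a (transfer a) (transferSeries a) (transfer-below a) (suc s) ⟩
    falling a (suc s) * mulPS f (transferSeries a) (suc s)
      ≈⟨ *-congˡ (trans (mulPS-suc f (transferSeries a) s) (trans (+-congʳ f₀*x≈0) (+-identityˡ _))) ⟩
    falling a (suc s) * (g S.* transferSeries a) s
      ≈⟨ *-congˡ (transferSeries-step a s) ⟩
    falling a (suc s) * transferSeries (a ℤ.- + 1) s
      ≈⟨ trans (*-congʳ (falling-suc a s)) (*-assoc _ _ _) ⟩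
    fromℤ (rnd a) * (falling (a ℤ.- + 1) s * transferSeries (a ℤ.- + 1) s)
      ≈⟨ *-congˡ (transfer-below (a ℤ.- + 1) s) ⟨
    fromℤ (rnd a) * transfer (a ℤ.- + 1) (a ℤ.- + 1 ℤ.- + s)
      ≡⟨ ≡.cong (λ i → fromℤ (rnd a) * transfer (a ℤ.- + 1) i) (i-1-j≡i-[1+j] a (+ s)) ⟩
    fromℤ (rnd a) * transfer (a ℤ.- + 1) (a ℤ.- + suc s)
      ∎
    where
    f₀*x≈0 : f 0 * transferSeries a (suc s) ≈ 0#
    f₀*x≈0 = trans (*-congʳ f₀≈0) (zeroˡ _)

  transfer-scaled : ∀ a j → fromℤ a * transfer a (a ℤ.- + j) ≈ falling a j * (fromℤ (a ℤ.- + j) * inversePower a j)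
  transfer-scaled a j = begin
    fromℤ a * transfer a (a ℤ.- + j)                       ≈⟨ *-congˡ (transfer-below a j) ⟩
    fromℤ a * (falling a j * transferSeries a j)           ≈⟨ solve 3 (λ x y z → x :* (y :* z) := y :* (x :* z)) refl _ _ _ ⟩
    falling a j * (fromℤ a * transferSeries a j)           ≈⟨ *-congˡ (transferSeries-scaled a j) ⟩
    falling a j * (fromℤ (a ℤ.- + j) * inversePower a j)   ∎

  inversePowerλ : ℤ → ℤ → Carrier
  inversePowerλ a = act (inversePower a) (a ℤ.- + 1) (lam (a ℤ.- + 1))

  shifted-above : ∀ a t → shift (inversePowerλ a) (a ℤ.+ + suc t) ≈ 0#
  shifted-above a t = shift-elim (_≈ 0#) (inversePowerλ a) (a ℤ.+ + suc t) (λ _ → refl) (λ _ → begin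
    inversePowerλ a (a ℤ.+ + suc t ℤ.- + 1)     ≡⟨ ≡.cong (inversePowerλ a) (i+j-1≡i-1+j a (+ suc t)) ⟩
    inversePowerλ a (a ℤ.- + 1 ℤ.+ + suc t)     ≈⟨ act-above (inversePower a) (a ℤ.- + 1) (lam (a ℤ.- + 1)) t ⟩
    0#                                          ∎)

  shifted-scaled : ∀ {a} j → a ≢ + 0 →
    fromℤ a * shift (inversePowerλ a) (a ℤ.- + j) ≈ falling a j * (fromℤ (a ℤ.- + j) * inversePower a j)
  shifted-scaled {a} j a≢0 = shift-elim (λ x → fromℤ a * x ≈ target) (inversePowerλ a) (a ℤ.- + j) at-0 elsewhere
    where
    target : Carrier
    target = falling a j * (fromℤ (a ℤ.- + j) * inversePower a j)

    at-0 : a ℤ.- + j ≡ + 0 → fromℤ a * 0# ≈ target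
    at-0 a-j≡0 = begin
      fromℤ a * 0#                            ≈⟨ zeroʳ _ ⟩
      0#                                      ≈⟨ trans (*-congˡ (zeroˡ _)) (zeroʳ _) ⟨
      falling a j * (0# * inversePower a j)   ≡⟨ ≡.cong (λ i → falling a j * (fromℤ i * inversePower a j)) a-j≡0 ⟨
      target                                  ∎

    elsewhere : a ℤ.- + j ≢ + 0 → fromℤ a * inversePowerλ a (a ℤ.- + j ℤ.- + 1) ≈ target
    elsewhere a-j≢0 = begin
      fromℤ a * inversePowerλ a (a ℤ.- + j ℤ.- + 1)
        ≡⟨ ≡.cong (λ i → fromℤ a * inversePowerλ a i) (i-j-1≡i-1-j a (+ j)) ⟩
      fromℤ a * inversePowerλ a (a ℤ.- + 1 ℤ.- + j)
        ≈⟨ *-congˡ (act-lam (inversePower a) (a ℤ.- + 1) j) ⟩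
      fromℤ a * (falling (a ℤ.- + 1) j * inversePower a j)
        ≈⟨ *-assoc _ _ _ ⟨
      (fromℤ a * falling (a ℤ.- + 1) j) * inversePower a j
        ≈⟨ *-congʳ (falling-shift a≢0 a-j≢0) ⟩
      (falling a j * fromℤ (a ℤ.- + j)) * inversePower a j
        ≈⟨ *-assoc _ _ _ ⟩
      target
        ∎

  transfer≈shift : ∀ a → a ≢ + 0 → ∀ m → transfer a m ≈ shift (inversePowerλ a) m
  transfer≈shift a a≢0 m with position a m
  ... | above t     = trans (transfer-above a t) (sym (shifted-above a t))
  ... | atOrBelow j = *-cancelˡ-nonzero (fromℤ-nonzero charZero a≢0)
                        (trans (transfer-scaled a j) (sym (shifted-scaled j a≢0)))

  transfer-isAssociated : IsAssociated f transfer
  transfer-isAssociated = record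
    { vanishes-above = transfer-above
    ; at-origin      = at-origin
    ; vanishes-at-0  = λ a a≢0 → transfer≈shift a a≢0 (+ 0)
    ; lowering       = transfer-lowering
    }
    where
    1+0≈1 : ∀ x → (1# + 0#) * x ≈ x
    1+0≈1 x = trans (*-congʳ (+-identityʳ 1#)) (*-identityˡ x)
    at-origin : transfer (+ 0) (+ 0) ≈ 1#
    at-origin = begin
      transfer (+ 0) (+ 0)                    ≈⟨ trans (transfer-below (+ 0) 0) (1+0≈1 _) ⟩
      transferSeries (+ 0) 0                  ≈⟨ mulPS-0 (derivative f) (inversePower (+ 1)) ⟩
      derivative f 0 * inversePower (+ 1) 0   ≈⟨ *-congʳ (1+0≈1 (g 0)) ⟩
      g 0 * inversePower (+ 1) 0              ≈⟨ mulPS-0 g (inversePower (+ 1)) ⟨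
      (g S.* inversePower (+ 1)) 0            ≈⟨ inversePower-step (+ 0) 0 ⟩
      1#                                      ∎

module Uniqueness {c ℓ : Level} (F : Field c ℓ) (charZero : Over.CharZero F) (f : Over.PS F)
                  (δ : Over.IsDelta F f) where
  open Over F
  open Arithmetic F
  open Factorials F using (rnd≢0)
  open Action F
  open SetoidReasoning setoid

  fromℤ-rnd≉0 : ∀ i → ¬ (fromℤ (rnd i) ≈ 0#)
  fromℤ-rnd≉0 i = fromℤ-nonzero charZero (rnd≢0 i)

  module _ (d : ℤ → ℤ → Carrier)
           (d-at-0 : ∀ a → d a (+ 0) ≈ 0#)
           (d-lowering : ∀ a m → act f a (d a) m ≈ fromℤ (rnd a) * d (a ℤ.- + 1) m)
           where

    diagonal : ℕ → ℤ → Carrier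
    diagonal k a = d a (a ℤ.- + k)

    LowerDiagonalsVanish : ℕ → Set ℓ
    LowerDiagonalsVanish k = ∀ {j} → j < k → ∀ b → diagonal j b ≈ 0#

    diagonal-relation : ∀ k → LowerDiagonalsVanish k → ∀ a →
      f 1 * (fromℤ (rnd (a ℤ.- + k)) * diagonal k a) ≈ fromℤ (rnd a) * diagonal k (a ℤ.- + 1)
    diagonal-relation k lower a = begin
      f 1 * (fromℤ (rnd (a ℤ.- + k)) * diagonal k a)
        ≈⟨ *-congˡ (*-congʳ (falling-1 (a ℤ.- + k))) ⟨
      f 1 * (falling (a ℤ.- + k) 1 * diagonal k a)
        ≈⟨ sumTo-single (suc (suc k)) 1 (s≤s (s≤s z≤n)) others ⟨
      sumTo (suc (suc k)) (λ n → f n * (falling (a ℤ.- + (suc k ℕ.∸ n)) n * d a (a ℤ.- + (suc k ℕ.∸ n))))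
        ≈⟨ act-below f a (d a) (suc k) ⟨
      act f a (d a) (a ℤ.- + suc k)
        ≈⟨ d-lowering a (a ℤ.- + suc k) ⟩
      fromℤ (rnd a) * d (a ℤ.- + 1) (a ℤ.- + suc k)
        ≡⟨ ≡.cong (λ i → fromℤ (rnd a) * d (a ℤ.- + 1) i) (i-1-j≡i-[1+j] a (+ k)) ⟨
      fromℤ (rnd a) * diagonal k (a ℤ.- + 1)
        ∎
      where
      others : ∀ n → n < suc (suc k) → n ≢ 1 →
               f n * (falling (a ℤ.- + (suc k ℕ.∸ n)) n * d a (a ℤ.- + (suc k ℕ.∸ n))) ≈ 0#
      others zero          _               _   = trans (*-congʳ (proj₁ δ)) (zeroˡ _)
      others (suc zero)    _               1≢1 = contradiction ≡.refl 1≢1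
      others (suc (suc i)) (s≤s (s≤s i<k)) _   =
        trans (*-congˡ (trans (*-congˡ (lower (ℕP.∸-monoʳ-< (s≤s z≤n) i<k) a)) (zeroʳ _))) (zeroʳ _)

    diagonal-step : ∀ k → LowerDiagonalsVanish k → ∀ b → diagonal k b ≈ 0# ⇔ diagonal k (ℤ.suc b) ≈ 0#
    diagonal-step k lower b = mk⇔
      (λ below≈0 → nonzero*y≈0⇒y≈0 (fromℤ-rnd≉0 (ℤ.suc b ℤ.- + k)) (nonzero*y≈0⇒y≈0 (proj₂ δ)
                     (trans relation (trans (*-congˡ below≈0) (zeroʳ _)))))
      (λ above≈0 → nonzero*y≈0⇒y≈0 (fromℤ-rnd≉0 (ℤ.suc b))
                     (trans (sym relation) (trans (*-congˡ (trans (*-congˡ above≈0) (zeroʳ _))) (zeroʳ _))))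
      where
      relation : f 1 * (fromℤ (rnd (ℤ.suc b ℤ.- + k)) * diagonal k (ℤ.suc b)) ≈ fromℤ (rnd (ℤ.suc b)) * diagonal k b
      relation = trans (diagonal-relation k lower (ℤ.suc b))
                       (reflexive (≡.cong (λ i → fromℤ (rnd (ℤ.suc b)) * diagonal k i) ([1+i]-1≡i b)))

    diagonal-vanishes : ∀ k a → diagonal k a ≈ 0#
    diagonal-vanishes = <-rec (λ k → ∀ a → diagonal k a ≈ 0#) (λ k lower →
      ℤ-induction (λ b → diagonal k b ≈ 0#) (diagonal-step k lower) {+ k} (diagonal-at-0 k))
      where
      diagonal-at-0 : ∀ k → diagonal k (+ k) ≈ 0#
      diagonal-at-0 k = trans (reflexive (≡.cong (d (+ k)) (ℤP.+-inverseʳ (+ k)))) (d-at-0 (+ k))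

    homogeneous-vanishes : (∀ a t → d a (a ℤ.+ + suc t) ≈ 0#) → ∀ a m → d a m ≈ 0#
    homogeneous-vanishes d-above a m with position a m
    ... | atOrBelow k = diagonal-vanishes k a
    ... | above t     = d-above a t

  associated-unique : ∀ {p q} → IsAssociated f p → IsAssociated f q → ∀ a m → p a m ≈ q a m
  associated-unique {p} {q} p-assoc q-assoc a m =
    x∙y⁻¹≈ε⇒x≈y _ _ (homogeneous-vanishes (λ a m → p a m - q a m) at-0 lowering vanishes-above a m)
    where
    open GroupProperties +-group using (x∙y⁻¹≈ε⇒x≈y)
    module P = IsAssociated p-assoc
    module Q = IsAssociated q-assoc

    0-0≈0 : ∀ {x y} → x ≈ 0# → y ≈ 0# → x - y ≈ 0#
    0-0≈0 x≈0 y≈0 = trans (+-cong x≈0 (-‿cong y≈0)) (-‿inverseʳ 0#)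

    vanishes-above : ∀ a t → p a (a ℤ.+ + suc t) - q a (a ℤ.+ + suc t) ≈ 0#
    vanishes-above a t = 0-0≈0 (P.vanishes-above a t) (Q.vanishes-above a t)

    at-0 : ∀ a → p a (+ 0) - q a (+ 0) ≈ 0#
    at-0 a with a ℤ.≟ + 0
    ... | yes ≡.refl = trans (+-cong P.at-origin (-‿cong Q.at-origin)) (-‿inverseʳ 1#)
    ... | no  a≢0    = 0-0≈0 (P.vanishes-at-0 a a≢0) (Q.vanishes-at-0 a a≢0)

    lowering : ∀ a m → act f a (λ i → p a i - q a i) m ≈ fromℤ (rnd a) * (p (a ℤ.- + 1) m - q (a ℤ.- + 1) m)
    lowering a m = begin
      act f a (λ i → p a i - q a i) m             ≈⟨ act-− f a (p a) (q a) m ⟩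
      act f a (p a) m - act f a (q a) m           ≈⟨ +-cong (P.lowering a m) (-‿cong (Q.lowering a m)) ⟩
      r * p (a ℤ.- + 1) m - r * q (a ℤ.- + 1) m   ≈⟨ solve 3 (λ r x y → r :* x :- r :* y := r :* (x :- y)) refl r _ _ ⟩
      r * (p (a ℤ.- + 1) m - q (a ℤ.- + 1) m)     ∎
      where
      r : Carrier
      r = fromℤ (rnd a)

mainTheorem15 : {c ℓ : Level} (F : Field c ℓ) →
  let open Over F in
  CharZero →
  (f : PS) (δ : IsDelta f) →
  -- p a m = coefficient of λ_m^α in p_a^α
  (p : ℤ → ℤ → Carrier) →
  -- p_a has degree a
  ((a : ℤ) → ¬ (p a a ≈ 0#) × ((m : ℤ) → a ℤ.< m → p a m ≈ 0#)) →
  -- ⟨α | p_0⟩ = 1,  ⟨α | p_a⟩ = 0 for a ≠ 0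
  p (+ 0) (+ 0) ≈ 1# →
  ((a : ℤ) → a ≢ + 0 → p a (+ 0) ≈ 0#) →
  -- f(D) p_a = ⌊a⌉ p_{a-1}
  ((a m : ℤ) → act f a (p a) m ≈ fromℤ (rnd a) * p (a ℤ.- + 1) m) →
  -- conclusion: p_a = sigma g(D)^(-a) lambda_(a-1), for a ≠ 0, 1
  (a : ℤ) → a ≢ + 0 → a ≢ + 1 → (m : ℤ) →
    p a m ≈ shift (act (powZ (divD f) (proj₂ δ) (ℤ.- a)) (a ℤ.- + 1) (lam (a ℤ.- + 1))) m
-- Neither the leading coefficient p a a ≉ 0 nor a ≢ 1 is needed: uniqueness only uses vanishing
-- above the degree, and the shifted formula holds for every a ≢ 0.
mainTheorem15 F charZero f δ p degree p₀₀≈1 p₀≈0 lowering a a≢0 _ m = begin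
  p a m        ≈⟨ associated-unique p-isAssociated transfer-isAssociated a m ⟩
  transfer a m ≈⟨ transfer≈shift a a≢0 m ⟩
  shift (act (powZ (divD f) (proj₂ δ) (ℤ.- a)) (a ℤ.- + 1) (lam (a ℤ.- + 1))) m ∎
  where
  open Over F
  open Action F using (IsAssociated)
  open Transfer F charZero f δ using (transfer; transfer-isAssociated; transfer≈shift)
  open Uniqueness F charZero f δ using (associated-unique)
  open SetoidReasoning setoid
  p-isAssociated : IsAssociated f p
  p-isAssociated = record
    { vanishes-above = λ a t → proj₂ (degree a) (a ℤ.+ + suc t) (i<i+[1+j] a t)
    ; at-origin      = p₀₀≈1
    ; vanishes-at-0  = p₀≈0
    ; lowering       = lowering
    }
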